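{- Let $n$ be a positive integer. For positive integers $n\ge m_1>m_2>\cdots>m_l$ with $m_l=1$, the family \[ q(n;m_1;m_2;\dots;m_l)=\binom{[n]}{m_1}\cup\binom{[m_1-1]}{m_2}\cup\cdots\cup\binom{[m_{l-1}-1]}{m_l} \] is union-free, i.e. no member of it equals a union of one or more other members of it.
   Context: $[n]=\{1,\dots,n\}$, and for a set $S$ and integer $k$, $\binom{S}{k}$ denotes the family of $k$-element subsets of $S$. $Q(n)$ denotes the set of all families $q(n;m_1;\dots;m_l)$ with $n\ge m_1>\cdots>m_l=1$; the claim says every family in $Q(n)$ is union-free. -}

module Defs where

open import Data.Nat using (ℕ; _∸_; _<ᵇ_)
open import Data.Fin using (Fin; toℕ)
open import Data.Fin.Subset using (Subset; _⊆_; ∣_∣; ⋃)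
open import Data.Vec using (tabulate)
open import Data.Bool using (Bool)
open import Data.List using (List; []; _∷_)
open import Data.List.Relation.Unary.All using (All)
open import Data.Sum using (_⊎_)
open import Data.Empty using (⊥)
open import Relation.Binary.PropositionalEquality using (_≡_; _≢_)

-- Ground set [n] = {1,…,n} is modelled by Fin n, element i ↦ toℕ i + 1.
-- [k] as a subset of [n] : elements i with toℕ i + 1 ≤ k, i.e. toℕ i < k.
below : (n k : ℕ) → Subset n
below n k = tabulate (λ i → toℕ i <ᵇ k)

-- Membership in the lower layers  binom([m_{i-1}-1], m_i), i = 2..l,
-- for the sequence ms = m₁ ∷ m₂ ∷ … ∷ m_l.
data InLower (n : ℕ) : List ℕ → Subset n → Set where
  here  : ∀ {m m′ ms A} → A ⊆ below n (m ∸ 1) → ∣ A ∣ ≡ m′ →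
          InLower n (m ∷ m′ ∷ ms) A
  there : ∀ {m ms A} → InLower n ms A → InLower n (m ∷ ms) A

q : (n m₁ : ℕ) → List ℕ → Subset n → Set
q n m₁ ms A = (∣ A ∣ ≡ m₁) ⊎ InLower n (m₁ ∷ ms) A

UnionFree : {n : ℕ} → (Subset n → Set) → Set
UnionFree {n} F = (A : Subset n) → F A →
  (B : Subset n) (Bs : List (Subset n)) →
  All F (B ∷ Bs) → All (λ C → C ≢ A) (B ∷ Bs) → A ≡ ⋃ (B ∷ Bs) → ⊥

-- A member A of q has size ∣A∣ = mᵢ for some layer i. Every member strictly
-- smaller than A lies in a later layer, and all later layers live inside
-- [mᵢ - 1]. If A were the union of members other than itself, these would be
-- proper subsets of A, hence smaller, so A itself would fit inside [∣A∣ - 1].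
module Submission where

open import Defs
open import Data.Nat using (ℕ; zero; suc; _≤_; _<_; _>_; _∸_; z≤n; s≤s)
open import Data.Nat.Properties
  using (≤-refl; ≤-trans; <⇒≤; <-≤-trans; ≤-<-trans; <-irrefl; <⇒≱; ∸-monoˡ-≤; ∸-monoʳ-<; module ≤-Reasoning)
open import Data.Fin using (Fin; toℕ) renaming (zero to fzero; suc to fsuc)
open import Data.Fin.Subset using (Subset; _∈_; _⊆_; ∣_∣; ⋃; inside; outside)
open import Data.Fin.Subset.Properties using (p⊆q⇒∣p∣≤∣q∣; ⊆-trans; p⊆p∪q; q⊆p∪q; x∈p∪q⁻; ∉⊥; drop-∷-⊆)
open import Data.Vec using ([]; _∷_; here; there)
open import Data.List using (List; []; _∷_; last)
open import Data.List.Membership.Propositional using () renaming (_∈_ to _∈ˡ_)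
open import Data.List.Relation.Unary.All as All using (All; []; _∷_)
open import Data.List.Relation.Unary.Any using (here; there)
open import Data.List.Relation.Unary.Linked using (Linked; _∷_)
open import Data.Maybe using (just)
open import Data.Product using (_,_; uncurry)
open import Data.Sum using (inj₁; inj₂)
open import Data.Empty using (⊥-elim)
open import Relation.Binary.PropositionalEquality using (_≡_; _≢_; refl; cong; sym; subst)

⊆∧≢⇒∣p∣<∣q∣ : ∀ {n} {p q : Subset n} → p ⊆ q → p ≢ q → ∣ p ∣ < ∣ q ∣
⊆∧≢⇒∣p∣<∣q∣ {p = []}          {[]}          _   p≢q = ⊥-elim (p≢q refl)
⊆∧≢⇒∣p∣<∣q∣ {p = outside ∷ p} {outside ∷ q} p⊆q p≢q =
  ⊆∧≢⇒∣p∣<∣q∣ (drop-∷-⊆ p⊆q) (λ p≡q → p≢q (cong (outside ∷_) p≡q))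
⊆∧≢⇒∣p∣<∣q∣ {p = outside ∷ p} {inside ∷ q}  p⊆q _   = s≤s (p⊆q⇒∣p∣≤∣q∣ (drop-∷-⊆ p⊆q))
⊆∧≢⇒∣p∣<∣q∣ {p = inside ∷ p}  {outside ∷ q} p⊆q _   with () ← p⊆q here
⊆∧≢⇒∣p∣<∣q∣ {p = inside ∷ p}  {inside ∷ q}  p⊆q p≢q =
  s≤s (⊆∧≢⇒∣p∣<∣q∣ (drop-∷-⊆ p⊆q) (λ p≡q → p≢q (cong (inside ∷_) p≡q)))

⋃-least : ∀ {n} {r : Subset n} (ps : List (Subset n)) → All (_⊆ r) ps → ⋃ ps ⊆ r
⋃-least []       []             x∈⋃ = ⊥-elim (∉⊥ x∈⋃)
⋃-least (p ∷ ps) (p⊆r ∷ ps⊆r) x∈⋃ with x∈p∪q⁻ p (⋃ ps) x∈⋃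
... | inj₁ x∈p   = p⊆r x∈p
... | inj₂ x∈⋃ps = ⋃-least ps ps⊆r x∈⋃ps

⊆⋃ : ∀ {n} (ps : List (Subset n)) → All (_⊆ ⋃ ps) ps
⊆⋃ []       = []
⊆⋃ (p ∷ ps) = p⊆p∪q (⋃ ps) ∷ All.map {P = _⊆ ⋃ ps} (λ r⊆⋃ps {x} → ⊆-trans r⊆⋃ps (q⊆p∪q p (⋃ ps)) {x}) (⊆⋃ ps)

∈below⁻ : ∀ n k {i : Fin n} → i ∈ below n k → toℕ i < k
∈below⁻ (suc n) zero    {fsuc i} (there i∈) with () ← ∈below⁻ n zero i∈
∈below⁻ (suc n) (suc k) {fzero}  here       = s≤s z≤n
∈below⁻ (suc n) (suc k) {fsuc i} (there i∈) = s≤s (∈below⁻ n k i∈)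

∈below⁺ : ∀ n k {i : Fin n} → toℕ i < k → i ∈ below n k
∈below⁺ (suc n) (suc k) {fzero}  _         = here
∈below⁺ (suc n) (suc k) {fsuc i} (s≤s i<k) = there (∈below⁺ n k i<k)

below-mono : ∀ n {a b} → a ≤ b → below n a ⊆ below n b
below-mono n {a} {b} a≤b i∈ = ∈below⁺ n b (<-≤-trans (∈below⁻ n a i∈) a≤b)

∣below∣≤ : ∀ n k → ∣ below n k ∣ ≤ k
∣below∣≤ zero    k       = z≤n
∣below∣≤ (suc n) zero    = ∣below∣≤ n zero
∣below∣≤ (suc n) (suc k) = s≤s (∣below∣≤ n k)

SmallerMembersBelow : ∀ {n} → (Subset n → Set) → Set
SmallerMembersBelow {n} F =
  ∀ {A C} → F A → F C → ∣ C ∣ < ∣ A ∣ → C ⊆ below n (∣ A ∣ ∸ 1)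

smallerMembersBelow⇒unionFree : ∀ {n} {F : Subset n → Set} →
  SmallerMembersBelow F → UnionFree F
smallerMembersBelow⇒unionFree {n} confined A FA B Bs FCs Cs≢A A≡⋃Cs =
  <-irrefl refl ∣A∣<∣A∣
  where
  Cs = B ∷ Bs
  a  = ∣ A ∣

  Cs⊆A : All (_⊆ A) Cs
  Cs⊆A = subst (λ X → All (_⊆ X) Cs) (sym A≡⋃Cs) (⊆⋃ Cs)

  Cs-smaller : All (λ C → ∣ C ∣ < a) Cs
  Cs-smaller = All.zipWith (uncurry ⊆∧≢⇒∣p∣<∣q∣) (Cs⊆A , Cs≢A)

  A⊆below : A ⊆ below n (a ∸ 1)
  A⊆below = subst (_⊆ below n (a ∸ 1)) (sym A≡⋃Cs)
    (⋃-least Cs (All.zipWith (uncurry (confined FA)) (FCs , Cs-smaller)))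

  0<a : 0 < a
  0<a = ≤-<-trans z≤n (All.head Cs-smaller)

  open ≤-Reasoning
  ∣A∣<∣A∣ : a < a
  ∣A∣<∣A∣ = begin-strict
    a                     ≤⟨ p⊆q⇒∣p∣≤∣q∣ A⊆below ⟩
    ∣ below n (a ∸ 1) ∣   ≤⟨ ∣below∣≤ n (a ∸ 1) ⟩
    a ∸ 1                 <⟨ ∸-monoʳ-< (s≤s z≤n) 0<a ⟩
    a                     ∎

∈-linked>⇒≤head : ∀ {a m ms} → Linked _>_ (m ∷ ms) → a ∈ˡ m ∷ ms → a ≤ m
∈-linked>⇒≤head _            (here refl) = ≤-refl
∈-linked>⇒≤head (m>m′ ∷ lnk) (there a∈)  = ≤-trans (∈-linked>⇒≤head lnk a∈) (<⇒≤ m>m′)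

InLower⇒∣A∣∈ : ∀ {n ms A} → InLower n ms A → ∣ A ∣ ∈ˡ ms
InLower⇒∣A∣∈ (here _ ∣A∣≡m′) = there (here ∣A∣≡m′)
InLower⇒∣A∣∈ (there A∈)      = there (InLower⇒∣A∣∈ A∈)

InLower⇒⊆below-head : ∀ {n m ms A} → Linked _>_ (m ∷ ms) →
  InLower n (m ∷ ms) A → A ⊆ below n (m ∸ 1)
InLower⇒⊆below-head _ (here A⊆ _) = A⊆
InLower⇒⊆below-head {n} (m>m′ ∷ lnk) (there A∈) =
  ⊆-trans (InLower⇒⊆below-head lnk A∈) (below-mono n (∸-monoˡ-≤ 1 (<⇒≤ m>m′)))

InLower⇒⊆below : ∀ {n a ms C} → Linked _>_ ms → a ∈ˡ ms →
  InLower n ms C → ∣ C ∣ < a → C ⊆ below n (a ∸ 1)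
InLower⇒⊆below lnk       (here refl) C∈ _ = InLower⇒⊆below-head lnk C∈
InLower⇒⊆below (_ ∷ lnk) (there a∈)  (here _ ∣C∣≡m′) ∣C∣<a =
  ⊥-elim (<⇒≱ ∣C∣<a (subst (_ ≤_) (sym ∣C∣≡m′) (∈-linked>⇒≤head lnk a∈)))
InLower⇒⊆below (_ ∷ lnk) (there a∈)  (there C∈) ∣C∣<a = InLower⇒⊆below lnk a∈ C∈ ∣C∣<a

q⇒∣A∣∈ : ∀ {n m₁ ms A} → q n m₁ ms A → ∣ A ∣ ∈ˡ m₁ ∷ ms
q⇒∣A∣∈ (inj₁ ∣A∣≡m₁) = here ∣A∣≡m₁
q⇒∣A∣∈ (inj₂ A∈)     = InLower⇒∣A∣∈ A∈

q-smallerMembersBelow : ∀ {n m₁ ms} → Linked _>_ (m₁ ∷ ms) → SmallerMembersBelow (q n m₁ ms)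
q-smallerMembersBelow lnk qA (inj₁ ∣C∣≡m₁) ∣C∣<∣A∣ =
  ⊥-elim (<⇒≱ (subst (_< _) ∣C∣≡m₁ ∣C∣<∣A∣) (∈-linked>⇒≤head lnk (q⇒∣A∣∈ qA)))
q-smallerMembersBelow lnk qA (inj₂ C∈)     ∣C∣<∣A∣ = InLower⇒⊆below lnk (q⇒∣A∣∈ qA) C∈ ∣C∣<∣A∣

mainTheorem2 : (n : ℕ) → 1 ≤ n → (m₁ : ℕ) (ms : List ℕ) →
    m₁ ≤ n → Linked _>_ (m₁ ∷ ms) → last (m₁ ∷ ms) ≡ just 1 →
    UnionFree (q n m₁ ms)
mainTheorem2 _ _ _ _ _ decreasing _ = smallerMembersBelow⇒unionFree (q-smallerMembersBelow decreasing)
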